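{- Let $A$ be a ring and $\mathbf{a}=(a_0,a_1,a_2,\dots)\in W(A)$. If $a_0$ is not a zero divisor in $A$, then the map $T_{\mathbf{a}}:W(A)\to W(A)$ is injective. If $a_0$ is invertible in $A$, then $T_{\mathbf{a}}$ is an isomorphism.
   Context: $W(A)$ is the ring of ($p$-typical) Witt vectors over $A$, $V$ the Verschiebung $(x_0,x_1,\dots)\mapsto(0,x_0,x_1,\dots)$, and $[x]=(x,0,0,\dots)$ the Teichmüller representative. For $\mathbf{a}=(a_0,a_1,\dots)\in W(A)$ the additive map $T_{\mathbf{a}}:W(A)\to W(A)$ is $T_{\mathbf{a}}\mathbf{x}=\sum_{k\ge0}V^k([a_k]\mathbf{x})$ (equivalently, defined by universal polynomials $T_r$ with $\Phi_n(T_0,\dots,T_n)=\sum_{i=0}^np^{n-i}A_{n-i}^{p^i}\Phi_i(X_0,\dots,X_i)$, $\Phi_r$ the Witt polynomials). -}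

module Defs where

-- p-typical Witt vectors over a commutative ring, and the map T_a, defined
-- through the universal integer polynomials T_r of the paper:
--   Φ_n(T_0,…,T_n) = Σ_{i=0}^n p^{n-i} A_{n-i}^{p^i} Φ_i(X_0,…,X_i),
-- i.e.  p^n T_n = Σ_{i=0}^n p^{n-i} A_{n-i}^{p^i} Φ_i(X) − Σ_{i<n} p^i T_i^{p^{n-i}}.
-- The division by p^n is exact in ℤ[A,X] (standard fact), so we compute it
-- coefficientwise with ℤ's floor division after collecting like monomials.

open import Level using (Level; _⊔_)
open import Algebra.Bundles using (CommutativeRing)
open import Data.Nat as ℕ using (ℕ; zero; suc)
open import Data.Integer as ℤ using (ℤ; +_; -[1+_])
open import Data.List using (List; []; _∷_; _++_; map; foldr; concatMap; zipWith; upTo; replicate)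
open import Data.Bool using (Bool; true; false; _∧_; if_then_else_)
open import Data.Product using (_×_; _,_; ∃)

-- a monomial: exponent lists (dense, missing entries = 0) of the A's and X's
Mono : Set
Mono = List ℕ × List ℕ

Term : Set
Term = ℤ × Mono

Poly : Set
Poly = List Term

addExp : List ℕ → List ℕ → List ℕ
addExp [] ys = ys
addExp (x ∷ xs) [] = x ∷ xs
addExp (x ∷ xs) (y ∷ ys) = (x ℕ.+ y) ∷ addExp xs ys

isZeroExp : List ℕ → Bool
isZeroExp [] = true
isZeroExp (x ∷ xs) = (x ℕ.≡ᵇ 0) ∧ isZeroExp xs

eqExp : List ℕ → List ℕ → Bool
eqExp [] ys = isZeroExp ys
eqExp (x ∷ xs) [] = isZeroExp (x ∷ xs)
eqExp (x ∷ xs) (y ∷ ys) = (x ℕ.≡ᵇ y) ∧ eqExp xs ys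

eqMono : Mono → Mono → Bool
eqMono (a , x) (b , y) = eqExp a b ∧ eqExp x y

mulMono : Mono → Mono → Mono
mulMono (a , x) (b , y) = addExp a b , addExp x y

insertT : Term → Poly → Poly
insertT t [] = t ∷ []
insertT (c , m) ((d , n) ∷ rest) =
  if eqMono m n then (c ℤ.+ d , n) ∷ rest else (d , n) ∷ insertT (c , m) rest

normalize : Poly → Poly
normalize = foldr insertT []

_⊕_ : Poly → Poly → Poly
P ⊕ Q = P ++ Q

negP : Poly → Poly
negP = map (λ { (c , m) → (ℤ.- c , m) })

_⊗_ : Poly → Poly → Poly
P ⊗ Q = concatMap (λ { (c , m) → map (λ { (d , n) → (c ℤ.* d , mulMono m n) }) Q }) P

constP : ℤ → Poly
constP c = (c , ([] , [])) ∷ []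

unitExp : ℕ → List ℕ
unitExp i = replicate i 0 ++ (1 ∷ [])

varA : ℕ → Poly
varA i = (+ 1 , (unitExp i , [])) ∷ []

varX : ℕ → Poly
varX i = (+ 1 , ([] , unitExp i)) ∷ []

powP : Poly → ℕ → Poly
powP P zero = constP (+ 1)
powP P (suc k) = P ⊗ powP P k

sumP : List Poly → Poly
sumP = foldr _⊕_ []

divP : ℕ → Poly → Poly
divP zero P = P
divP (suc k) P = map (λ { (c , m) → (c ℤ./ℕ (suc k) , m) }) P

module WittPolys (p : ℕ) where

  Φ : ℕ → Poly
  Φ n = sumP (map (λ i → constP (+ (p ℕ.^ i)) ⊗ powP (varX i) (p ℕ.^ (n ℕ.∸ i))) (upTo (suc n)))

  rhs : ℕ → Poly
  rhs n = sumP (map (λ i → constP (+ (p ℕ.^ (n ℕ.∸ i))) ⊗ (powP (varA (n ℕ.∸ i)) (p ℕ.^ i) ⊗ Φ i)) (upTo (suc n)))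

  newT : ℕ → List Poly → Poly
  newT n prev = divP (p ℕ.^ n) (normalize (rhs n ⊕ negP (sumP
    (zipWith (λ i Ti → constP (+ (p ℕ.^ i)) ⊗ powP Ti (p ℕ.^ (n ℕ.∸ i))) (upTo n) prev))))

  Ts : ℕ → List Poly
  Ts zero = []
  Ts (suc n) = Ts n ++ (newT n (Ts n) ∷ [])

  Tpoly : ℕ → Poly
  Tpoly n = newT n (Ts n)

module _ {c ℓ : Level} (R : CommutativeRing c ℓ) where
  open CommutativeRing R

  natR : ℕ → Carrier
  natR zero = 0#
  natR (suc n) = 1# + natR n

  intR : ℤ → Carrier
  intR (+ n) = natR n
  intR -[1+ n ] = - natR (suc n)

  powR : Carrier → ℕ → Carrier
  powR x zero = 1#
  powR x (suc k) = x * powR x k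

  evalExp : (ℕ → Carrier) → ℕ → List ℕ → Carrier
  evalExp env k [] = 1#
  evalExp env k (e ∷ es) = powR (env k) e * evalExp env (suc k) es

  evalPoly : (ℕ → Carrier) → (ℕ → Carrier) → Poly → Carrier
  evalPoly α ξ = foldr (λ { (c , (ea , ex)) acc → intR c * evalExp α 0 ea * evalExp ξ 0 ex + acc }) 0#

  W : Set c
  W = ℕ → Carrier

  _≋_ : W → W → Set ℓ
  x ≋ y = ∀ n → x n ≈ y n

  T : (p : ℕ) → W → W → W
  T p a x n = evalPoly a x (WittPolys.Tpoly p n)

  NonZeroDivisor : Carrier → Set (c ⊔ ℓ)
  NonZeroDivisor a = ∀ b → a * b ≈ 0# → b ≈ 0#

  IsUnit : Carrier → Set (c ⊔ ℓ)
  IsUnit a = ∃ λ u → a * u ≈ 1#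

{-# OPTIONS --safe #-}
module Submission where

-- X_n occurs in Σ_{i ≤ n} p^{n-i} A_{n-i}^{p^i} Φ_i only through the summand A_0^{p^n} Φ_n, and there
-- only as p^n A_0^{p^n} X_n; by induction the T_i with i < n involve only X_0, …, X_{n-1}. Hence
-- T_n = A_0^{p^n} X_n + G_n(A; X_0, …, X_{n-1}), i.e. T_a is triangular with diagonal a_0^{p^n}.
-- If a_0 is a non-zero-divisor, so is every a_0^{p^n}, and T_a x = T_a y forces x_n = y_n by
-- strong induction on n; if a_0 is a unit, the equations (T_a x)_n = y_n are solved for
-- x_0, x_1, … in turn.

open import Defs
open import Level using (Level; _⊔_)
open import Algebra.Bundles using (CommutativeRing)
open import Data.Nat using (ℕ)
open import Data.Nat.Primality using (Prime)
open import Data.Product using (_×_)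
open import Function.Definitions using (Injective; Surjective; Bijective)

import Algebra.Properties.CommutativeSemigroup as CommutativeSemigroupProperties
import Algebra.Properties.Ring as RingProperties
open import Data.Bool using (true; false; _∧_)
open import Data.Bool.Properties using (∧-zeroʳ)
open import Data.Empty using (⊥)
open import Data.Integer as ℤ using (ℤ; +_)
import Data.Integer.Properties as ℤ
open import Data.List using (List; []; _∷_; _++_; _∷ʳ_; map; upTo; zipWith)
open import Data.List.Properties using (++-assoc; map-++; upTo-∷ʳ)
open import Data.List.Relation.Unary.All as All using (All; []; _∷_)
open import Data.List.Relation.Unary.All.Properties using (++⁺; map⁺; applyUpTo⁺₁)
open import Data.Nat as ℕ using (zero; suc; _≤_; _<_; z≤n; s≤s; NonZero; _^_; _∸_; _≟_)
import Data.Nat.Properties as ℕ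
open import Data.Nat.DivMod using (n/n≡1)
open import Data.Nat.Induction using (<-rec)
open import Data.Nat.Primality using (prime⇒nonZero)
open import Data.Product using (_,_; proj₁; proj₂)
open import Data.Sum using (inj₁; inj₂)
open import Data.Unit using (⊤; tt)
open import Function using (id; _∘_)
open import Relation.Binary.PropositionalEquality as ≡ using (_≡_; _≢_; refl; cong; cong₂; subst)
open import Relation.Nullary using (yes; no; contradiction)

VanishesFrom : ℕ → List ℕ → Set
VanishesFrom n       []       = ⊤
VanishesFrom zero    (e ∷ es) = e ≡ 0 × VanishesFrom zero es
VanishesFrom (suc n) (e ∷ es) = VanishesFrom n es

IsUnitVector : ℕ → List ℕ → Set
IsUnitVector n       []       = ⊥
IsUnitVector zero    (e ∷ es) = e ≡ 1 × VanishesFrom zero es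
IsUnitVector (suc n) (e ∷ es) = e ≡ 0 × IsUnitVector n es

addExp-identityʳ : ∀ es → addExp es [] ≡ es
addExp-identityʳ []      = refl
addExp-identityʳ (_ ∷ _) = refl

vanishesFrom-addExp : ∀ n es fs → VanishesFrom n es → VanishesFrom n fs → VanishesFrom n (addExp es fs)
vanishesFrom-addExp n       []       _        _            v            = v
vanishesFrom-addExp n       (_ ∷ _)  []       v            _            = v
vanishesFrom-addExp zero    (_ ∷ es) (_ ∷ fs) (refl , ves) (refl , vfs) = refl , vanishesFrom-addExp zero es fs ves vfs
vanishesFrom-addExp (suc n) (_ ∷ es) (_ ∷ fs) ves          vfs          = vanishesFrom-addExp n es fs ves vfs

vanishesFrom-mono : ∀ {m n} es → m ≤ n → VanishesFrom m es → VanishesFrom n es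
vanishesFrom-mono                 []       _         _       = tt
vanishesFrom-mono {zero}  {zero}  (_ ∷ _)  _         v       = v
vanishesFrom-mono {zero}  {suc n} (_ ∷ es) _         (_ , v) = vanishesFrom-mono es z≤n v
vanishesFrom-mono {suc m} {suc n} (_ ∷ es) (s≤s m≤n) v       = vanishesFrom-mono es m≤n v

unitExp-vanishesFrom : ∀ i → VanishesFrom (suc i) (unitExp i)
unitExp-vanishesFrom zero    = tt
unitExp-vanishesFrom (suc i) = unitExp-vanishesFrom i

unitExp-isUnitVector : ∀ i → IsUnitVector i (unitExp i)
unitExp-isUnitVector zero    = refl , tt
unitExp-isUnitVector (suc i) = refl , unitExp-isUnitVector i

isUnitVector⇒vanishesFrom : ∀ n es → IsUnitVector n es → VanishesFrom (suc n) es
isUnitVector⇒vanishesFrom zero    (_ ∷ _)  (_ , v) = v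
isUnitVector⇒vanishesFrom (suc n) (_ ∷ es) (_ , u) = isUnitVector⇒vanishesFrom n es u

isUnitVector⇒¬isZeroExp : ∀ n es → IsUnitVector n es → isZeroExp es ≡ false
isUnitVector⇒¬isZeroExp zero    (_ ∷ _)  (refl , _) = refl
isUnitVector⇒¬isZeroExp (suc n) (_ ∷ es) (refl , u) = isUnitVector⇒¬isZeroExp n es u

eqExp-vanishesFrom-isUnitVector : ∀ n es fs → VanishesFrom n es → IsUnitVector n fs → eqExp es fs ≡ false
eqExp-vanishesFrom-isUnitVector zero    []       (_ ∷ _)  _          (refl , _) = refl
eqExp-vanishesFrom-isUnitVector zero    (_ ∷ _)  (_ ∷ _)  (refl , _) (refl , _) = refl
eqExp-vanishesFrom-isUnitVector (suc n) []       (_ ∷ fs) _          (refl , u) = isUnitVector⇒¬isZeroExp n fs u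
eqExp-vanishesFrom-isUnitVector (suc n) (e ∷ es) (_ ∷ fs) v          (refl , u) =
  ≡.trans (cong ((e ℕ.≡ᵇ 0) ∧_) (eqExp-vanishesFrom-isUnitVector n es fs v u)) (∧-zeroʳ _)

≡ᵇ-comm : ∀ m n → (m ℕ.≡ᵇ n) ≡ (n ℕ.≡ᵇ m)
≡ᵇ-comm zero    zero    = refl
≡ᵇ-comm zero    (suc n) = refl
≡ᵇ-comm (suc m) zero    = refl
≡ᵇ-comm (suc m) (suc n) = ≡ᵇ-comm m n

eqExp-comm : ∀ es fs → eqExp es fs ≡ eqExp fs es
eqExp-comm []       []       = refl
eqExp-comm []       (_ ∷ _)  = refl
eqExp-comm (_ ∷ _)  []       = refl
eqExp-comm (e ∷ es) (f ∷ fs) = cong₂ _∧_ (≡ᵇ-comm e f) (eqExp-comm es fs)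

eqMono-comm : ∀ m m′ → eqMono m m′ ≡ eqMono m′ m
eqMono-comm (ea , ex) (fa , fx) = cong₂ _∧_ (eqExp-comm ea fa) (eqExp-comm ex fx)

eqMono-vanishesFrom-isUnitVector : ∀ n m m′ → VanishesFrom n (proj₂ m) → IsUnitVector n (proj₂ m′) →
  eqMono m m′ ≡ false
eqMono-vanishesFrom-isUnitVector n (ea , ex) (fa , fx) v u =
  ≡.trans (cong (eqExp ea fa ∧_) (eqExp-vanishesFrom-isUnitVector n ex fx v u)) (∧-zeroʳ _)

XBelow : ℕ → Term → Set
XBelow n (_ , (_ , ex)) = VanishesFrom n ex

PolyXBelow : ℕ → Poly → Set
PolyXBelow n = All (XBelow n)

polyXBelow-mono : ∀ {m n P} → m ≤ n → PolyXBelow m P → PolyXBelow n P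
polyXBelow-mono m≤n = All.map λ {t} → vanishesFrom-mono (proj₂ (proj₂ t)) m≤n

polyXBelow-⊗ : ∀ {n} P Q → PolyXBelow n P → PolyXBelow n Q → PolyXBelow n (P ⊗ Q)
polyXBelow-⊗ []                  Q []         bQ = []
polyXBelow-⊗ ((_ , (_ , ex)) ∷ P) Q (bt ∷ bP) bQ =
  ++⁺ (map⁺ (All.map (λ {u} → vanishesFrom-addExp _ ex (proj₂ (proj₂ u)) bt) bQ)) (polyXBelow-⊗ P Q bP bQ)

polyXBelow-powP : ∀ {n} P k → PolyXBelow n P → PolyXBelow n (powP P k)
polyXBelow-powP P zero    _  = tt ∷ []
polyXBelow-powP P (suc k) bP = polyXBelow-⊗ P (powP P k) bP (polyXBelow-powP P k bP)

polyXBelow-sumP : ∀ {n Ps} → All (PolyXBelow n) Ps → PolyXBelow n (sumP Ps)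
polyXBelow-sumP []         = []
polyXBelow-sumP (bP ∷ bPs) = ++⁺ bP (polyXBelow-sumP bPs)

polyXBelow-sumUpTo : ∀ {n} m (f : ℕ → Poly) → (∀ {i} → i < m → PolyXBelow n (f i)) →
  PolyXBelow n (sumP (map f (upTo m)))
polyXBelow-sumUpTo m f bf = polyXBelow-sumP (map⁺ (applyUpTo⁺₁ id m bf))

polyXBelow-sumP-zipWith : ∀ {n} (h : ℕ → Poly → Poly) → (∀ i {Q} → PolyXBelow n Q → PolyXBelow n (h i Q)) →
  ∀ is {Qs} → All (PolyXBelow n) Qs → PolyXBelow n (sumP (zipWith h is Qs))
polyXBelow-sumP-zipWith h bh []       _          = []
polyXBelow-sumP-zipWith h bh (_ ∷ _)  []         = []
polyXBelow-sumP-zipWith h bh (i ∷ is) (bQ ∷ bQs) = ++⁺ (bh i bQ) (polyXBelow-sumP-zipWith h bh is bQs)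

polyXBelow-insertT : ∀ {n} t P → XBelow n t → PolyXBelow n P → PolyXBelow n (insertT t P)
polyXBelow-insertT t       []            bt []        = bt ∷ []
polyXBelow-insertT (c , m) ((d , m′) ∷ P) bt (bu ∷ bP) with eqMono m m′
... | true  = bu ∷ bP
... | false = bu ∷ polyXBelow-insertT (c , m) P bt bP

polyXBelow-normalize : ∀ {n P} → PolyXBelow n P → PolyXBelow n (normalize P)
polyXBelow-normalize {P = []}    []        = []
polyXBelow-normalize {P = t ∷ P} (bt ∷ bP) = polyXBelow-insertT t (normalize P) bt (polyXBelow-normalize bP)

varX-xBelow : ∀ i → PolyXBelow (suc i) (varX i)
varX-xBelow i = unitExp-vanishesFrom i ∷ []

DiagonalTerm : ℕ → ℤ → List ℕ → Term → Set
DiagonalTerm n c ea (d , (eb , ex)) = d ≡ c × eb ≡ ea × IsUnitVector n ex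

record DiagonalSplit (n : ℕ) (c : ℤ) (ea : List ℕ) (P : Poly) : Set where
  constructor split
  field
    before        : Poly
    diagonal      : Term
    after         : Poly
    splits        : P ≡ before ++ diagonal ∷ after
    before-xBelow : PolyXBelow n before
    diagonal-term : DiagonalTerm n c ea diagonal
    after-xBelow  : PolyXBelow n after

open DiagonalSplit

module _ {n : ℕ} {c : ℤ} {ea : List ℕ} where

  split-++ʳ : ∀ {P Q} → DiagonalSplit n c ea P → PolyXBelow n Q → DiagonalSplit n c ea (P ++ Q)
  split-++ʳ {Q = Q} (split G₁ s G₂ refl b₁ ds b₂) bQ =
    split G₁ s (G₂ ++ Q) (++-assoc G₁ (s ∷ G₂) Q) b₁ ds (++⁺ b₂ bQ)

  split-++ˡ : ∀ {P Q} → PolyXBelow n Q → DiagonalSplit n c ea P → DiagonalSplit n c ea (Q ++ P)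
  split-++ˡ {Q = Q} bQ (split G₁ s G₂ refl b₁ ds b₂) =
    split (Q ++ G₁) s G₂ (≡.sym (++-assoc Q G₁ (s ∷ G₂))) (++⁺ bQ b₁) ds b₂

  split-sumP-∷ʳ : ∀ {Q} Ps → All (PolyXBelow n) Ps → DiagonalSplit n c ea Q → DiagonalSplit n c ea (sumP (Ps ∷ʳ Q))
  split-sumP-∷ʳ []       []         d = split-++ʳ d []
  split-sumP-∷ʳ (_ ∷ Ps) (bP ∷ bPs) d = split-++ˡ bP (split-sumP-∷ʳ Ps bPs d)

  split-sumUpTo : ∀ (f : ℕ → Poly) → (∀ {i} → i < n → PolyXBelow n (f i)) → DiagonalSplit n c ea (f n) →
    DiagonalSplit n c ea (sumP (map f (upTo (suc n))))
  split-sumUpTo f bf d =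
    subst (DiagonalSplit n c ea ∘ sumP) map-upTo-∷ʳ (split-sumP-∷ʳ (map f (upTo n)) (map⁺ (applyUpTo⁺₁ id n bf)) d)
    where
    map-upTo-∷ʳ : map f (upTo n) ∷ʳ f n ≡ map f (upTo (suc n))
    map-upTo-∷ʳ = ≡.trans (≡.sym (map-++ f (upTo n) (n ∷ []))) (cong (map f) (upTo-∷ʳ n))

  -- The diagonal monomial contains X_n, so it is never merged with a term in X_0, …, X_{n-1}.
  split-insertT : ∀ {P} t → XBelow n t → DiagonalSplit n c ea P → DiagonalSplit n c ea (insertT t P)
  split-insertT t bt (split G₁ s G₂ refl b₁ ds b₂) = go G₁ b₁
    where
    go : ∀ G → PolyXBelow n G → DiagonalSplit n c ea (insertT t (G ++ s ∷ G₂))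
    go [] [] with eqMono (proj₂ t) (proj₂ s)
                | eqMono-vanishesFrom-isUnitVector n (proj₂ t) (proj₂ s) bt (proj₂ (proj₂ ds))
    ... | false | _ = split [] s (insertT t G₂) refl [] ds (polyXBelow-insertT t G₂ bt b₂)
    go (u ∷ G) (bu ∷ bG) with eqMono (proj₂ t) (proj₂ u)
    ... | true  = split (_ ∷ G) s G₂ refl (bu ∷ bG) ds b₂
    ... | false = split-++ˡ (bu ∷ []) (go G bG)

  insertT-diagonal : ∀ {Q} s → DiagonalTerm n c ea s → PolyXBelow n Q → DiagonalSplit n c ea (insertT s Q)
  insertT-diagonal s ds [] = split [] s [] refl [] ds []
  insertT-diagonal s ds (_∷_ {x = t} bt bQ)
    with eqMono (proj₂ s) (proj₂ t)
       | ≡.trans (eqMono-comm (proj₂ s) (proj₂ t)) (eqMono-vanishesFrom-isUnitVector n (proj₂ t) (proj₂ s) bt (proj₂ (proj₂ ds)))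
  ... | false | _ = split-++ˡ (bt ∷ []) (insertT-diagonal s ds bQ)

  split-normalize : ∀ {P} → DiagonalSplit n c ea P → DiagonalSplit n c ea (normalize P)
  split-normalize (split G₁ s G₂ refl b₁ ds b₂) = go G₁ b₁
    where
    go : ∀ G → PolyXBelow n G → DiagonalSplit n c ea (normalize (G ++ s ∷ G₂))
    go []      []        = insertT-diagonal s ds (polyXBelow-normalize b₂)
    go (t ∷ G) (bt ∷ bG) = split-insertT t bt (go G bG)

split-map : ∀ {n c c′ ea ea′ P} (f : Term → Term) → (∀ {t} → XBelow n t → XBelow n (f t)) →
  (∀ {t} → DiagonalTerm n c ea t → DiagonalTerm n c′ ea′ (f t)) →
  DiagonalSplit n c ea P → DiagonalSplit n c′ ea′ (map f P)
split-map f bf df (split G₁ s G₂ refl b₁ ds b₂) =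
  split (map f G₁) (f s) (map f G₂) (map-++ f G₁ (s ∷ G₂)) (map⁺ (All.map bf b₁)) (df ds) (map⁺ (All.map bf b₂))

-- divP floors every coefficient; only the diagonal one is known to be divisible, and
-- the others may change harmlessly since they stay off the diagonal.
split-divP : ∀ {n ea P} m .{{_ : NonZero m}} → DiagonalSplit n (+ m) ea P → DiagonalSplit n (+ 1) ea (divP m P)
split-divP (suc k) = split-map _ id divide
  where
  divide : ∀ {n ea t} → DiagonalTerm n (+ suc k) ea t → DiagonalTerm n (+ 1) ea _
  divide {t = .(+ suc k) , _} (refl , eb≡ea , u) = cong +_ (n/n≡1 (suc k)) , eb≡ea , u

split-⊗-A-monomial : ∀ {n c ea Q} eb → DiagonalSplit n c ea Q →
  DiagonalSplit n c (addExp eb ea) (((+ 1 , (eb , [])) ∷ []) ⊗ Q)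
split-⊗-A-monomial eb d = split-++ʳ (split-map _ id multiply d) []
  where
  multiply : ∀ {n c ea t} → DiagonalTerm n c ea t → DiagonalTerm n c (addExp eb ea) _
  multiply {t = _ , _} (refl , refl , u) = ℤ.*-identityˡ _ , refl , u

offDiagonal : ∀ {n c ea P} → DiagonalSplit n c ea P → Poly
offDiagonal d = before d ++ after d

offDiagonal-xBelow : ∀ {n c ea P} (d : DiagonalSplit n c ea P) → PolyXBelow n (offDiagonal d)
offDiagonal-xBelow d = ++⁺ (before-xBelow d) (after-xBelow d)

A₀-exp : ℕ → List ℕ
A₀-exp zero    = []
A₀-exp (suc k) = suc k ∷ []

powP-varA₀ : ∀ k → powP (varA 0) k ≡ (+ 1 , (A₀-exp k , [])) ∷ []
powP-varA₀ zero          = refl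
powP-varA₀ (suc zero)    = refl
powP-varA₀ (suc (suc k)) = cong (varA 0 ⊗_) (powP-varA₀ (suc k))

module _ (p : ℕ) .{{_ : NonZero p}} where
  open WittPolys p

  Φ-summand-xBelow : ∀ {n i} → i < n → ∀ k → PolyXBelow n (constP (+ (p ^ i)) ⊗ powP (varX i) k)
  Φ-summand-xBelow {i = i} i<n k = polyXBelow-⊗ (constP (+ (p ^ i))) (powP (varX i) k) (tt ∷ [])
    (polyXBelow-powP (varX i) k (polyXBelow-mono i<n (varX-xBelow i)))

  Φ-xBelow : ∀ n → PolyXBelow (suc n) (Φ n)
  Φ-xBelow n = polyXBelow-sumUpTo (suc n) _ λ {i} i≤n → Φ-summand-xBelow i≤n (p ^ (n ∸ i))

  Φ-split : ∀ n → DiagonalSplit n (+ (p ^ n)) [] (Φ n)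
  Φ-split n = split-sumUpTo _ (λ {i} i<n → Φ-summand-xBelow i<n (p ^ (n ∸ i))) diagonal-summand
    where
    diagonal-summand : DiagonalSplit n (+ (p ^ n)) [] (constP (+ (p ^ n)) ⊗ powP (varX n) (p ^ (n ∸ n)))
    diagonal-summand rewrite ℕ.n∸n≡0 n = split [] _ [] refl [] p^n·Xₙ []
      where
      p^n·Xₙ : DiagonalTerm n (+ (p ^ n)) [] (+ (p ^ n) ℤ.* + 1 , ([] , addExp (unitExp n) []))
      p^n·Xₙ = ℤ.*-identityʳ _ , refl , subst (IsUnitVector n) (≡.sym (addExp-identityʳ (unitExp n))) (unitExp-isUnitVector n)

  rhs-split : ∀ n → DiagonalSplit n (+ (p ^ n)) (A₀-exp (p ^ n)) (rhs n)
  rhs-split n = split-sumUpTo _ summand-xBelow diagonal-summand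
    where
    summand-xBelow : ∀ {i} → i < n → PolyXBelow n (constP (+ (p ^ (n ∸ i))) ⊗ (powP (varA (n ∸ i)) (p ^ i) ⊗ Φ i))
    summand-xBelow {i} i<n = polyXBelow-⊗ (constP (+ (p ^ (n ∸ i)))) _ (tt ∷ [])
      (polyXBelow-⊗ (powP (varA (n ∸ i)) (p ^ i)) (Φ i) (polyXBelow-powP (varA (n ∸ i)) (p ^ i) (tt ∷ []))
        (polyXBelow-mono i<n (Φ-xBelow i)))
    diagonal-summand : DiagonalSplit n (+ (p ^ n)) (A₀-exp (p ^ n))
      (constP (+ (p ^ (n ∸ n))) ⊗ (powP (varA (n ∸ n)) (p ^ n) ⊗ Φ n))
    diagonal-summand rewrite ℕ.n∸n≡0 n | powP-varA₀ (p ^ n) =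
      subst (λ ea → DiagonalSplit n (+ (p ^ n)) ea (constP (+ 1) ⊗ (((+ 1 , (A₀-exp (p ^ n) , [])) ∷ []) ⊗ Φ n)))
        (addExp-identityʳ (A₀-exp (p ^ n)))
        (split-⊗-A-monomial [] (split-⊗-A-monomial (A₀-exp (p ^ n)) (Φ-split n)))

  newT-split : ∀ n {Qs} → All (PolyXBelow n) Qs → DiagonalSplit n (+ 1) (A₀-exp (p ^ n)) (newT n Qs)
  newT-split n {Qs} bQs = split-divP (p ^ n) {{ℕ.m^n≢0 p n}}
    (split-normalize (split-++ʳ (rhs-split n) (map⁺ (polyXBelow-sumP-zipWith _ summand-xBelow (upTo n) bQs))))
    where
    summand-xBelow : ∀ i {Q} → PolyXBelow n Q → PolyXBelow n (constP (+ (p ^ i)) ⊗ powP Q (p ^ (n ∸ i)))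
    summand-xBelow i {Q} bQ = polyXBelow-⊗ (constP (+ (p ^ i))) (powP Q (p ^ (n ∸ i))) (tt ∷ [])
      (polyXBelow-powP Q (p ^ (n ∸ i)) bQ)

  split⇒polyXBelow-suc : ∀ {n c ea P} → DiagonalSplit n c ea P → PolyXBelow (suc n) P
  split⇒polyXBelow-suc {n} (split G₁ s G₂ refl b₁ ds b₂) =
    ++⁺ (polyXBelow-mono (ℕ.n≤1+n n) b₁) (isUnitVector⇒vanishesFrom n _ (proj₂ (proj₂ ds)) ∷ polyXBelow-mono (ℕ.n≤1+n n) b₂)

  Ts-xBelow : ∀ n → All (PolyXBelow n) (Ts n)
  Ts-xBelow zero    = []
  Ts-xBelow (suc n) =
    ++⁺ (All.map (polyXBelow-mono (ℕ.n≤1+n n)) (Ts-xBelow n)) (split⇒polyXBelow-suc (newT-split n (Ts-xBelow n)) ∷ [])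

  Tpoly-split : ∀ n → DiagonalSplit n (+ 1) (A₀-exp (p ^ n)) (Tpoly n)
  Tpoly-split n = newT-split n (Ts-xBelow n)

update : ∀ {a} {A : Set a} → (ℕ → A) → ℕ → A → ℕ → A
update f n v i with i ≟ n
... | yes _ = v
... | no  _ = f i

update-≡ : ∀ {a} {A : Set a} (f : ℕ → A) n v → update f n v n ≡ v
update-≡ f n v with n ≟ n
... | yes _   = refl
... | no  n≢n = contradiction refl n≢n

update-≢ : ∀ {a} {A : Set a} (f : ℕ → A) {n} v {i} → i ≢ n → update f n v i ≡ f i
update-≢ f {n} v {i} i≢n with i ≟ n
... | yes i≡n = contradiction i≡n i≢n
... | no  _   = refl

module _ {c ℓ : Level} (R : CommutativeRing c ℓ) where
  open CommutativeRing R renaming (refl to ≈-refl) hiding (zero)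
  open RingProperties ring using (+-cancelˡ; x∙y⁻¹≈ε⇒x≈y; x[y-z]≈xy-xz; \\-leftDividesˡ)
  open CommutativeSemigroupProperties *-commutativeSemigroup using (interchange)
  open import Relation.Binary.Reasoning.Setoid setoid

  nonZeroDivisor-cancelˡ : ∀ {a x y} → NonZeroDivisor R a → a * x ≈ a * y → x ≈ y
  nonZeroDivisor-cancelˡ {a} {x} {y} nzd ax≈ay = x∙y⁻¹≈ε⇒x≈y x y (nzd (x - y) (begin
    a * (x - y)   ≈⟨ x[y-z]≈xy-xz a x y ⟩
    a * x - a * y ≈⟨ +-congʳ ax≈ay ⟩
    a * y - a * y ≈⟨ -‿inverseʳ (a * y) ⟩
    0#            ∎))

  nonZeroDivisor-powR : ∀ {a} → NonZeroDivisor R a → ∀ k → NonZeroDivisor R (powR R a k)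
  nonZeroDivisor-powR nzd zero    b 1b≈0   = trans (sym (*-identityˡ b)) 1b≈0
  nonZeroDivisor-powR nzd (suc k) b aakb≈0 = nonZeroDivisor-powR nzd k b (nzd _ (trans (sym (*-assoc _ _ _)) aakb≈0))

  isUnit⇒nonZeroDivisor : ∀ {a} → IsUnit R a → NonZeroDivisor R a
  isUnit⇒nonZeroDivisor {a} (u , au≈1) b ab≈0 = begin
    b           ≈⟨ *-identityˡ b ⟨
    1# * b      ≈⟨ *-congʳ (trans (*-comm u a) au≈1) ⟨
    (u * a) * b ≈⟨ *-assoc u a b ⟩
    u * (a * b) ≈⟨ *-congˡ ab≈0 ⟩
    u * 0#      ≈⟨ zeroʳ u ⟩
    0#          ∎

  isUnit-powR : ∀ {a} → IsUnit R a → ∀ k → IsUnit R (powR R a k)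
  isUnit-powR unit         zero    = 1# , *-identityʳ 1#
  isUnit-powR {a} (u , au≈1) (suc k) with isUnit-powR (u , au≈1) k
  ... | v , akv≈1 = u * v , (begin
    (a * powR R a k) * (u * v) ≈⟨ interchange a (powR R a k) u v ⟩
    (a * u) * (powR R a k * v) ≈⟨ *-cong au≈1 akv≈1 ⟩
    1# * 1#                    ≈⟨ *-identityˡ 1# ⟩
    1#                         ∎)

  isUnit-cancelˡ : ∀ {a u} → a * u ≈ 1# → ∀ x → a * (u * x) ≈ x
  isUnit-cancelˡ {a} {u} au≈1 x = begin
    a * (u * x) ≈⟨ *-assoc a u x ⟨
    (a * u) * x ≈⟨ *-congʳ au≈1 ⟩
    1# * x      ≈⟨ *-identityˡ x ⟩
    x           ∎

  record Triangular (F : W R → W R) : Set (c ⊔ ℓ) where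
    field
      diag        : ℕ → Carrier
      lower       : ℕ → W R → Carrier
      lower-local : ∀ n {x y} → (∀ {i} → i < n → x i ≈ y i) → lower n x ≈ lower n y
      decompose   : ∀ n x → F x n ≈ lower n x + diag n * x n

  module _ {F : W R → W R} (tri : Triangular F) where
    open Triangular tri

    triangular-injective : (∀ n → NonZeroDivisor R (diag n)) → Injective (_≋_ R) (_≋_ R) F
    triangular-injective nzd {x} {y} Fx≋Fy = <-rec _ agree
      where
      agree : ∀ n → (∀ {i} → i < n → x i ≈ y i) → x n ≈ y n
      agree n agree-below = nonZeroDivisor-cancelˡ (nzd n) (+-cancelˡ (lower n x) _ _ (begin
        lower n x + diag n * x n ≈⟨ decompose n x ⟨
        F x n                    ≈⟨ Fx≋Fy n ⟩
        F y n                    ≈⟨ decompose n y ⟩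
        lower n y + diag n * y n ≈⟨ +-congʳ (lower-local n agree-below) ⟨
        lower n x + diag n * y n ∎))

    triangular-surjective : (∀ n → IsUnit R (diag n)) → Surjective (_≋_ R) (_≋_ R) F
    triangular-surjective unit y = x , solves
      where
      solve : ℕ → W R → Carrier
      solve n x = proj₁ (unit n) * (- lower n x + y n)

      -- approx n carries the first n entries of the preimage, and zeros after them.
      approx : ℕ → W R
      approx zero    = λ _ → 0#
      approx (suc n) = update (approx n) n (solve n (approx n))

      x : W R
      x n = approx (suc n) n

      approx-stable : ∀ n {i} → i < n → approx n i ≡ x i
      approx-stable (suc n) {i} i<1+n with ℕ.m<1+n⇒m<n∨m≡n i<1+n
      ... | inj₂ refl = refl
      ... | inj₁ i<n  = ≡.trans (update-≢ (approx n) _ (ℕ.<⇒≢ i<n)) (approx-stable n i<n)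

      solves : ∀ {z} → _≋_ R z x → _≋_ R (F z) y
      solves {z} z≋x n = begin
        F z n                                             ≈⟨ decompose n z ⟩
        lower n z + diag n * z n                          ≈⟨ +-cong (lower-local n z≈approx) (*-congˡ z≈solve) ⟩
        lower n (approx n) + diag n * solve n (approx n)  ≈⟨ +-congˡ (isUnit-cancelˡ (proj₂ (unit n)) _) ⟩
        lower n (approx n) + (- lower n (approx n) + y n) ≈⟨ \\-leftDividesˡ (lower n (approx n)) (y n) ⟩
        y n                                               ∎
        where
        z≈approx : ∀ {i} → i < n → z i ≈ approx n i
        z≈approx i<n = trans (z≋x _) (reflexive (≡.sym (approx-stable n i<n)))
        z≈solve : z n ≈ solve n (approx n)
        z≈solve = trans (z≋x n) (reflexive (update-≡ (approx n) n _))

  powR-cong : ∀ {u v} k → u ≈ v → powR R u k ≈ powR R v k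
  powR-cong zero    u≈v = ≈-refl
  powR-cong (suc k) u≈v = *-cong u≈v (powR-cong k u≈v)

  evalTerm : W R → W R → Term → Carrier
  evalTerm α ξ (d , (ea , ex)) = intR R d * evalExp R α 0 ea * evalExp R ξ 0 ex

  evalPoly-extract : ∀ α ξ G₁ s G₂ → evalPoly R α ξ (G₁ ++ s ∷ G₂) ≈ evalPoly R α ξ (G₁ ++ G₂) + evalTerm α ξ s
  evalPoly-extract α ξ []       s G₂ = +-comm _ _
  evalPoly-extract α ξ (t ∷ G₁) s G₂ = trans (+-congˡ (evalPoly-extract α ξ G₁ s G₂)) (sym (+-assoc _ _ _))

  evalExp-vanishesFrom-zero : ∀ ξ k es → VanishesFrom 0 es → evalExp R ξ k es ≈ 1#
  evalExp-vanishesFrom-zero ξ k []       _            = ≈-refl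
  evalExp-vanishesFrom-zero ξ k (_ ∷ es) (refl , v) = trans (*-identityˡ _) (evalExp-vanishesFrom-zero ξ (suc k) es v)

  evalExp-local : ∀ {ξ ξ′} n k es → VanishesFrom n es → (∀ {i} → i < k ℕ.+ n → ξ i ≈ ξ′ i) →
    evalExp R ξ k es ≈ evalExp R ξ′ k es
  evalExp-local         n       k []       _ _     = ≈-refl
  evalExp-local {ξ} {ξ′} zero    k es@(_ ∷ _) v _  =
    trans (evalExp-vanishesFrom-zero ξ k es v) (sym (evalExp-vanishesFrom-zero ξ′ k es v))
  evalExp-local         (suc n) k (e ∷ es) v agree =
    *-cong (powR-cong e (agree (ℕ.m<m+n k ℕ.z<s)))
           (evalExp-local n (suc k) es v (λ {i} i<1+k+n → agree (subst (i <_) (≡.sym (ℕ.+-suc k n)) i<1+k+n)))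

  evalPoly-local : ∀ α {ξ ξ′} n P → PolyXBelow n P → (∀ {i} → i < n → ξ i ≈ ξ′ i) →
    evalPoly R α ξ P ≈ evalPoly R α ξ′ P
  evalPoly-local α n []                   []        _     = ≈-refl
  evalPoly-local α n ((_ , (_ , ex)) ∷ P) (bt ∷ bP) agree =
    +-cong (*-congˡ (evalExp-local n 0 ex bt agree)) (evalPoly-local α n P bP agree)

  evalExp-isUnitVector : ∀ ξ n k es → IsUnitVector n es → evalExp R ξ k es ≈ ξ (k ℕ.+ n)
  evalExp-isUnitVector ξ zero    k (_ ∷ es) (refl , v) = begin
    (ξ k * 1#) * evalExp R ξ (suc k) es ≈⟨ *-cong (*-identityʳ (ξ k)) (evalExp-vanishesFrom-zero ξ (suc k) es v) ⟩
    ξ k * 1#                            ≈⟨ *-identityʳ (ξ k) ⟩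
    ξ k                                 ≈⟨ reflexive (cong ξ (ℕ.+-identityʳ k)) ⟨
    ξ (k ℕ.+ 0)                         ∎
  evalExp-isUnitVector ξ (suc n) k (_ ∷ es) (refl , u) = begin
    1# * evalExp R ξ (suc k) es ≈⟨ *-identityˡ _ ⟩
    evalExp R ξ (suc k) es      ≈⟨ evalExp-isUnitVector ξ n (suc k) es u ⟩
    ξ (suc k ℕ.+ n)             ≈⟨ reflexive (cong ξ (ℕ.+-suc k n)) ⟨
    ξ (k ℕ.+ suc n)             ∎

  evalExp-A₀-exp : ∀ α k → evalExp R α 0 (A₀-exp k) ≈ powR R (α 0) k
  evalExp-A₀-exp α zero    = ≈-refl
  evalExp-A₀-exp α (suc k) = *-identityʳ _

  evalTerm-diagonal : ∀ α ξ {n k} t → DiagonalTerm n (+ 1) (A₀-exp k) t → evalTerm α ξ t ≈ powR R (α 0) k * ξ n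
  evalTerm-diagonal α ξ {n} {k} (_ , (_ , ex)) (refl , refl , u) = begin
    (natR R 1 * evalExp R α 0 (A₀-exp k)) * evalExp R ξ 0 ex ≈⟨ *-cong (*-cong (+-identityʳ 1#) (evalExp-A₀-exp α k)) (evalExp-isUnitVector ξ n 0 ex u) ⟩
    (1# * powR R (α 0) k) * ξ n                            ≈⟨ *-congʳ (*-identityˡ _) ⟩
    powR R (α 0) k * ξ n                                   ∎

  evalPoly-diagonalSplit : ∀ α ξ {n k P} (d : DiagonalSplit n (+ 1) (A₀-exp k) P) →
    evalPoly R α ξ P ≈ evalPoly R α ξ (offDiagonal d) + powR R (α 0) k * ξ n
  evalPoly-diagonalSplit α ξ (split G₁ s G₂ refl _ ds _) =
    trans (evalPoly-extract α ξ G₁ s G₂) (+-congˡ (evalTerm-diagonal α ξ s ds))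

  T-triangular : ∀ p .{{_ : NonZero p}} a → Triangular (T R p a)
  T-triangular p a = record
    { diag        = λ n → powR R (a 0) (p ^ n)
    ; lower       = λ n x → evalPoly R a x (offDiagonal (Tpoly-split p n))
    ; lower-local = λ n → evalPoly-local a n _ (offDiagonal-xBelow (Tpoly-split p n))
    ; decompose   = λ n x → evalPoly-diagonalSplit a x (Tpoly-split p n)
    }

lemma6p1p4 : {c ℓ : Level} (p : ℕ) → Prime p → (R : CommutativeRing c ℓ) → (a : W R) →
    (NonZeroDivisor R (a 0) → Injective (_≋_ R) (_≋_ R) (T R p a))
    × (IsUnit R (a 0) → Bijective (_≋_ R) (_≋_ R) (T R p a))
lemma6p1p4 p p-prime R a = injective , λ unit →
  injective (isUnit⇒nonZeroDivisor R unit) , triangular-surjective R T-tri (λ n → isUnit-powR R unit (p ^ n))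
  where
  instance _ = prime⇒nonZero p-prime
  T-tri : Triangular R (T R p a)
  T-tri = T-triangular R p a
  injective : NonZeroDivisor R (a 0) → Injective (_≋_ R) (_≋_ R) (T R p a)
  injective nzd = triangular-injective R T-tri (λ n → nonZeroDivisor-powR R nzd (p ^ n))
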